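{- Let $\alpha$ be a positive rational number and let $\mathcal T_1=(T_1,\nu_1)$ and $\mathcal T_2=(T_2,\nu_2)$ be factorization trees for $\alpha$. If $\sigma$ is a homomorphism from $\mathcal T_1$ to $\mathcal T_2$, then (i) $\sigma$ is injective and edge-preserving, and (ii) if $\tau$ is any homomorphism from $\mathcal T_1$ to $\mathcal T_2$ then $\sigma=\tau$.
   Context: Write $\alpha=a/b$ with $a,b$ coprime positive integers. Let $p_1\ge\cdots\ge p_N$ be the primes dividing $ab$, listed with multiplicity. Put $\gamma(i)=1$ if $p_i\mid a$, $\gamma(i)=-1$ if $p_i\mid b$, and $\alpha_n=\prod_{i=1}^n p_i^{\gamma(i)}$ for $0\le n\le N$ (so $\alpha_0=1$, $\alpha_N=\alpha$). A factorization of a positive rational $\beta$ is a sequence $(a_1/b_1,a_2/b_2,\dots)$ with $a_i,b_i$ positive integers, $a_i=b_i=1$ for all but finitely many $i$, $\prod_i a_i/b_i=\beta$, $\max\{a_i,b_i\}\ge\max\{a_{i+1},b_{i+1}\}$ for all $i$, and $\gcd(a_i,b_j)=1$ for all $i,j$. Let $\mathfrak F_\alpha$ be the set of all factorizations of $\alpha_n$, $0\le n\le N$. For $0\le n<N$, a factorization $(a_i/b_i)$ of $\alpha_n$ is a direct subfactorization of a factorization $(c_i/d_i)$ of $\alpha_{n+1}$ if either $p_{n+1}\mid a$ and for some $k$: $d_i=b_i$ for all $i$, $c_i=a_i$ for $i\ne k$, $c_k=a_kp_{n+1}$; or $p_{n+1}\mid b$ and for some $k$: $c_i=a_i$ for all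 $i$, $d_i=b_i$ for $i\ne k$, $d_k=b_kp_{n+1}$. A tree data structure for a set $X$ is a pair $(T,\nu)$ where $T$ is a rooted tree, viewed as a digraph with an edge $(r,s)$ from each vertex to each of its children, and $\nu:V(T)\to X$ is a map; its parenting map $\phi$ sends each non-root vertex to its parent. A factorization tree for $\alpha$ is a tree data structure $(T,\nu)$ for $\mathfrak F_\alpha$ such that: (1) the root $r_0$ satisfies $\nu(r_0)=(1,1,\dots)$; (2) if $n<N$ and $\nu(r)$ is a factorization of $\alpha_n$ then $r$ has at least one child; (3) if $\nu(r)=\nu(s)$ and $\phi(r)=\phi(s)$ then $r=s$; (4) for each non-root vertex $r$, $\nu(\phi(r))$ is a direct subfactorization of $\nu(r)$. A homomorphism from $(T_1,\nu_1)$ to $(T_2,\nu_2)$ is a map $\sigma:V(T_1)\to V(T_2)$ with $(\sigma(g),\sigma(h))\in E(T_2)$ whenever $(g,h)\in E(T_1)$ and $\nu_2(\sigma(r))=\nu_1(r)$ for all $r$. It is edge-preserving if $(g,h)\in E(T_1)\iff(\sigma(g),\sigma(h))\in E(T_2)$. -}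

module Defs where

open import Data.Nat using (ℕ; zero; suc; _+_; _*_; _≤_; _<_; _⊔_; NonZero)
open import Data.Nat.Divisibility using (_∣_; _∣?_)
open import Data.Nat.Coprimality using (Coprime)
open import Data.Nat.Primality using (Prime)
open import Data.Bool using (if_then_else_)
open import Data.Fin using (Fin; fromℕ<)
open import Data.List using (List; []; _∷_; length; lookup; take; product)
open import Data.List.Relation.Unary.All using (All)
open import Data.List.Relation.Unary.Linked using (Linked)
open import Data.Maybe using (Maybe; just; nothing; _>>=_)
open import Data.Product using (_×_; _,_; proj₁; proj₂; Σ; ∃; ∃-syntax)
open import Data.Sum using (_⊎_)
open import Relation.Nullary using (¬_; does)
open import Relation.Binary.PropositionalEquality using (_≡_; _≢_)

-- Sequences of pairs (a_i , b_i), read as the formal sequence of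
-- fractions a_i / b_i (indices start at 0 here instead of 1).

Seq : Set
Seq = ℕ → ℕ × ℕ

_≈_ : Seq → Seq → Set
f ≈ g = ∀ i → f i ≡ g i

trivialSeq : Seq
trivialSeq _ = (1 , 1)

prodNum : ℕ → Seq → ℕ
prodNum zero    f = 1
prodNum (suc M) f = prodNum M f * proj₁ (f M)

prodDen : ℕ → Seq → ℕ
prodDen zero    f = 1
prodDen (suc M) f = prodDen M f * proj₂ (f M)

maxPair : ℕ × ℕ → ℕ
maxPair (x , y) = x ⊔ y

-- The product ∏ a_i / ∏ b_i (a finite product, since all but finitely
-- many terms are 1/1) equals c / d, written as cross-multiplication.
record IsFactorization (c d : ℕ) (f : Seq) : Set where
  field
    pos-num   : ∀ i → 1 ≤ proj₁ (f i)
    pos-den   : ∀ i → 1 ≤ proj₂ (f i)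
    support   : ℕ
    trivial   : ∀ i → support ≤ i → f i ≡ (1 , 1)
    product≡  : prodNum support f * d ≡ c * prodDen support f
    monotone  : ∀ i → maxPair (f (suc i)) ≤ maxPair (f i)
    coprime   : ∀ i j → Coprime (proj₁ (f i)) (proj₂ (f j))

-- The data attached to α = a / b.
-- ps is the list p_1 ≥ ... ≥ p_N of primes dividing ab with multiplicity.

-- numerator / denominator of ∏ p_i^{γ(i)} over a list of primes
numPart : ℕ → List ℕ → ℕ
numPart a []       = 1
numPart a (p ∷ ps) = if does (p ∣? a) then p * numPart a ps else numPart a ps

denPart : ℕ → List ℕ → ℕ
denPart b []       = 1
denPart b (p ∷ ps) = if does (p ∣? b) then p * denPart b ps else denPart b ps

alphaNum : ℕ → ℕ → List ℕ → ℕ → ℕ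
alphaNum a b ps n = numPart a (take n ps)

alphaDen : ℕ → ℕ → List ℕ → ℕ → ℕ
alphaDen a b ps n = denPart b (take n ps)

IsFactOfAlpha : ℕ → ℕ → List ℕ → ℕ → Seq → Set
IsFactOfAlpha a b ps n f = IsFactorization (alphaNum a b ps n) (alphaDen a b ps n) f

InFα : ℕ → ℕ → List ℕ → Seq → Set
InFα a b ps f = ∃[ n ] (n ≤ length ps × IsFactOfAlpha a b ps n f)

DirectSubStep : ℕ → ℕ → ℕ → Seq → Seq → Set
DirectSubStep a b p f g =
    (p ∣ a × ∃[ k ] ((∀ i → proj₂ (g i) ≡ proj₂ (f i))
                   × (∀ i → i ≢ k → proj₁ (g i) ≡ proj₁ (f i))
                   × proj₁ (g k) ≡ proj₁ (f k) * p))
  ⊎ (p ∣ b × ∃[ k ] ((∀ i → proj₁ (g i) ≡ proj₁ (f i))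
                   × (∀ i → i ≢ k → proj₂ (g i) ≡ proj₂ (f i))
                   × proj₂ (g k) ≡ proj₂ (f k) * p))

DirectSub : ℕ → ℕ → List ℕ → Seq → Seq → Set
DirectSub a b ps f g =
  Σ ℕ λ n → Σ (n < length ps) λ n<N →
      IsFactOfAlpha a b ps n f
    × IsFactOfAlpha a b ps (suc n) g
    × DirectSubStep a b (lookup ps (fromℕ< n<N)) f g

ancestor : {V : Set} → (V → Maybe V) → ℕ → V → Maybe V
ancestor parent zero    v = just v
ancestor parent (suc k) v = ancestor parent k v >>= parent

record RootedTree : Set₁ where
  field
    V            : Set
    root         : V
    parent       : V → Maybe V
    parent-root  : parent root ≡ nothing
    parent-other : ∀ v → parent v ≡ nothing → v ≡ root
    reaches-root : ∀ v → ∃[ k ] (ancestor parent k v ≡ just root)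

  Edge : V → V → Set
  Edge r s = parent s ≡ just r

record TreeDS (a b : ℕ) (ps : List ℕ) : Set₁ where
  field
    tree : RootedTree
  open RootedTree tree public
  field
    ν   : V → Seq
    ν∈F : ∀ r → InFα a b ps (ν r)

record IsFactorizationTree (a b : ℕ) (ps : List ℕ) (𝒯 : TreeDS a b ps) : Set where
  open TreeDS 𝒯
  field
    cond1 : ν root ≈ trivialSeq
    cond2 : ∀ r n → n < length ps → IsFactOfAlpha a b ps n (ν r) → ∃[ s ] Edge r s
    cond3 : ∀ r s → ν r ≈ ν s → parent r ≡ parent s → r ≡ s
    cond4 : ∀ r u → parent r ≡ just u → DirectSub a b ps (ν u) (ν r)

module _ {a b : ℕ} {ps : List ℕ} (𝒯₁ 𝒯₂ : TreeDS a b ps) where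
  private
    module T₁ = TreeDS 𝒯₁
    module T₂ = TreeDS 𝒯₂

  IsHomomorphism : (T₁.V → T₂.V) → Set
  IsHomomorphism σ =
      (∀ g h → T₁.Edge g h → T₂.Edge (σ g) (σ h))
    × (∀ r → T₂.ν (σ r) ≈ T₁.ν r)

  IsEdgePreserving : (T₁.V → T₂.V) → Set
  IsEdgePreserving σ = ∀ g h → T₂.Edge (σ g) (σ h) → T₁.Edge g h

  IsInjective : (T₁.V → T₂.V) → Set
  IsInjective σ = ∀ x y → σ x ≡ σ y → x ≡ y

module Submission where

-- A homomorphism of factorization trees is forced, vertex by vertex, from
-- the root downwards.  Two facts drive everything:
--
--  * in a factorization tree only the root carries the trivial label
--    (1/1, 1/1, …): every other vertex is a direct superfactorization of
--    its parent, i.e. one entry got multiplied by a prime p ≠ 1;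
--  * condition (3): siblings are determined by their labels.
--
-- Since homomorphisms preserve labels, σ maps the root to the root and
-- nothing else to the root.  Every vertex reaches the root, so rooted trees
-- support induction from the root towards the leaves (tree-induction).
-- Injectivity of σ and uniqueness of σ then follow by tree induction:
-- two vertices (resp. two images) with equal labels and equal parents
-- coincide by condition (3).  Edge preservation is a consequence of
-- injectivity together with "only the root is sent to the root".

open import Defs
open import Data.Nat using (ℕ; zero; suc; _*_; NonZero)
open import Data.Nat.Coprimality using (Coprime)
open import Data.Nat.Primality using (Prime)
open import Data.List using (List)
open import Data.Nat.ListAction using (product)
open import Data.List.Relation.Unary.All using (All)
open import Data.List.Relation.Unary.Linked using (Linked)
open import Data.Nat using (_≥_)
open import Data.Product using (_×_)
open import Relation.Binary.PropositionalEquality using (_≡_)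

open import Data.Nat.Properties using (m*n≡1⇒n≡1)
open import Data.Nat.Primality using (¬prime[1])
import Data.List.Relation.Unary.All as All
open import Data.List.Membership.Propositional.Properties using (∈-lookup)
open import Data.Maybe using (just; nothing)
open import Data.Maybe.Properties using (just-injective)
open import Data.Fin using (fromℕ<)
open import Data.Product using (_,_; proj₁; proj₂)
open import Data.Sum using (inj₁; inj₂)
open import Data.Empty using (⊥-elim)
open import Relation.Nullary using (¬_)
open import Relation.Binary.PropositionalEquality using (refl; sym; trans; cong; subst)

≈-sym : ∀ {f g} → f ≈ g → g ≈ f
≈-sym f≈g i = sym (f≈g i)

≈-trans : ∀ {f g h} → f ≈ g → g ≈ h → f ≈ h
≈-trans f≈g g≈h i = trans (f≈g i) (g≈h i)

-- A direct superfactorization by a prime never has the trivial label: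
-- its modified entry equals (old entry) · p, which cannot be 1.
directSubStep-nontrivial : ∀ {a b p f g} → Prime p →
  DirectSubStep a b p f g → ¬ g ≈ trivialSeq
directSubStep-nontrivial {p = p} {f} p-prime (inj₁ (_ , k , _ , _ , gk≡fk*p)) g≈1 =
  ¬prime[1] (subst Prime (m*n≡1⇒n≡1 (proj₁ (f k)) p
    (trans (sym gk≡fk*p) (cong proj₁ (g≈1 k)))) p-prime)
directSubStep-nontrivial {p = p} {f} p-prime (inj₂ (_ , k , _ , _ , gk≡fk*p)) g≈1 =
  ¬prime[1] (subst Prime (m*n≡1⇒n≡1 (proj₂ (f k)) p
    (trans (sym gk≡fk*p) (cong proj₂ (g≈1 k)))) p-prime)

directSub-nontrivial : ∀ {a b ps f g} → All Prime ps →
  DirectSub a b ps f g → ¬ g ≈ trivialSeq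
directSub-nontrivial ps-prime (n , n<N , _ , _ , step) =
  directSubStep-nontrivial (All.lookup ps-prime (∈-lookup (fromℕ< n<N))) step

module TreeInduction (T : RootedTree) where
  open RootedTree T

  -- A property of the k-th ancestor passes down to the vertex itself.
  -- (If the k-th ancestor does not exist, neither does the (k+1)-st, so
  -- only the case where it exists needs a clause.)
  inherit-from-ancestor : (P : V → Set) →
    (∀ v u → parent v ≡ just u → P u → P v) →
    ∀ k v w → ancestor parent k v ≡ just w → P w → P v
  inherit-from-ancestor P step zero v w anc≡w Pw
    with refl ← just-injective anc≡w = Pw
  inherit-from-ancestor P step (suc k) v w anc≡w Pw
    with ancestor parent k v in anc≡u
  ... | just u = inherit-from-ancestor P step k v u anc≡u (step u w anc≡w Pw)

  tree-induction : (P : V → Set) → P root →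
    (∀ v u → parent v ≡ just u → P u → P v) → ∀ v → P v
  tree-induction P P-root step v =
    inherit-from-ancestor P step (proj₁ (reaches-root v)) v root
      (proj₂ (reaches-root v)) P-root

module FactorizationTree {a b : ℕ} {ps : List ℕ} (ps-prime : All Prime ps)
  (𝒯 : TreeDS a b ps) (ft : IsFactorizationTree a b ps 𝒯) where
  open TreeDS 𝒯
  open IsFactorizationTree ft

  trivial-label⇒root : ∀ v → ν v ≈ trivialSeq → v ≡ root
  trivial-label⇒root v v≈1 with parent v in parent≡
  ... | nothing = parent-other v parent≡
  ... | just u  = ⊥-elim (directSub-nontrivial ps-prime (cond4 v u parent≡) v≈1)

module Homomorphism {a b : ℕ} {ps : List ℕ} (ps-prime : All Prime ps)
  (𝒯₁ 𝒯₂ : TreeDS a b ps)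
  (ft₁ : IsFactorizationTree a b ps 𝒯₁) (ft₂ : IsFactorizationTree a b ps 𝒯₂)
  (σ : TreeDS.V 𝒯₁ → TreeDS.V 𝒯₂) (hom : IsHomomorphism 𝒯₁ 𝒯₂ σ) where
  private
    module T₁ = TreeDS 𝒯₁
    module T₂ = TreeDS 𝒯₂
    module F₁ = IsFactorizationTree ft₁

  maps-edges : ∀ g h → T₁.Edge g h → T₂.Edge (σ g) (σ h)
  maps-edges = proj₁ hom

  keeps-labels : ∀ r → T₂.ν (σ r) ≈ T₁.ν r
  keeps-labels = proj₂ hom

  -- The root is labelled trivially, hence so is its image.
  root↦root : σ T₁.root ≡ T₂.root
  root↦root = FactorizationTree.trivial-label⇒root ps-prime 𝒯₂ ft₂ (σ T₁.root)
    (≈-trans (keeps-labels T₁.root) F₁.cond1)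

  child↦non-root : ∀ x u → T₁.parent x ≡ just u → ¬ σ x ≡ T₂.root
  child↦non-root x u parent≡u σx≡root with () ← trans (sym (maps-edges u x parent≡u))
    (trans (cong T₂.parent σx≡root) T₂.parent-root)

  only-root↦root : ∀ y → σ y ≡ T₂.root → y ≡ T₁.root
  only-root↦root y σy≡root with T₁.parent y in parent≡
  ... | nothing = T₁.parent-other y parent≡
  ... | just u  = ⊥-elim (child↦non-root y u parent≡ σy≡root)

  -- Induction on x: if σ x ≡ σ y, the parents of x and y have equal images,
  -- hence are equal, and x, y are siblings with equal labels.
  injective : IsInjective 𝒯₁ 𝒯₂ σ
  injective = TreeInduction.tree-induction T₁.tree
    (λ x → ∀ y → σ x ≡ σ y → x ≡ y) root-case child-case
    where
    root-case : ∀ y → σ T₁.root ≡ σ y → T₁.root ≡ y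
    root-case y σroot≡σy = sym (only-root↦root y (trans (sym σroot≡σy) root↦root))

    child-case : ∀ x u → T₁.parent x ≡ just u →
      (∀ y → σ u ≡ σ y → u ≡ y) → ∀ y → σ x ≡ σ y → x ≡ y
    child-case x u parent≡u inj-u y σx≡σy with T₁.parent y in parent≡
    ... | nothing = ⊥-elim (child↦non-root x u parent≡u (trans σx≡σy
                      (trans (cong σ (T₁.parent-other y parent≡)) root↦root)))
    ... | just w = F₁.cond3 x y same-label
                     (trans parent≡u (trans (cong just u≡w) (sym parent≡)))
      where
      u≡w : u ≡ w
      u≡w = inj-u w (just-injective (trans (sym (maps-edges u x parent≡u))
              (trans (cong T₂.parent σx≡σy) (maps-edges w y parent≡))))

      same-label : T₁.ν x ≈ T₁.ν y
      same-label = ≈-trans (≈-sym (keeps-labels x))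
        (≈-trans (λ i → cong (λ z → T₂.ν z i) σx≡σy) (keeps-labels y))

  -- If σ h is a child of σ g, then h is not the root; its parent u satisfies
  -- σ u ≡ σ g, so u ≡ g by injectivity.
  edge-preserving : IsEdgePreserving 𝒯₁ 𝒯₂ σ
  edge-preserving g h σg→σh with T₁.parent h in parent≡
  ... | nothing with () ← trans (sym σg→σh)
        (trans (cong (λ z → T₂.parent (σ z)) (T₁.parent-other h parent≡))
               (trans (cong T₂.parent root↦root) T₂.parent-root))
  ... | just u = cong just (injective u g
        (just-injective (trans (sym (maps-edges u h parent≡)) σg→σh)))

-- Two homomorphisms agree: at the root both give the root, and children of
-- vertices where they agree have images that are siblings with equal labels.
homomorphism-unique : ∀ {a b ps} → All Prime ps →
  (𝒯₁ 𝒯₂ : TreeDS a b ps) →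
  IsFactorizationTree a b ps 𝒯₁ → IsFactorizationTree a b ps 𝒯₂ →
  (σ : TreeDS.V 𝒯₁ → TreeDS.V 𝒯₂) → IsHomomorphism 𝒯₁ 𝒯₂ σ →
  (τ : TreeDS.V 𝒯₁ → TreeDS.V 𝒯₂) → IsHomomorphism 𝒯₁ 𝒯₂ τ → ∀ r → σ r ≡ τ r
homomorphism-unique ps-prime 𝒯₁ 𝒯₂ ft₁ ft₂ σ hσ τ hτ =
  TreeInduction.tree-induction (TreeDS.tree 𝒯₁) (λ r → σ r ≡ τ r)
    (trans Hσ.root↦root (sym Hτ.root↦root)) child-case
  where
  module Hσ = Homomorphism ps-prime 𝒯₁ 𝒯₂ ft₁ ft₂ σ hσ
  module Hτ = Homomorphism ps-prime 𝒯₁ 𝒯₂ ft₁ ft₂ τ hτ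

  child-case : ∀ r u → TreeDS.parent 𝒯₁ r ≡ just u → σ u ≡ τ u → σ r ≡ τ r
  child-case r u parent≡u σu≡τu = IsFactorizationTree.cond3 ft₂ (σ r) (τ r)
    (≈-trans (Hσ.keeps-labels r) (≈-sym (Hτ.keeps-labels r)))
    (trans (Hσ.maps-edges u r parent≡u)
      (trans (cong just σu≡τu) (sym (Hτ.maps-edges u r parent≡u))))

theorem2p3 : (a b : ℕ) → NonZero a → NonZero b → Coprime a b →
    (ps : List ℕ) → All Prime ps → Linked _≥_ ps → product ps ≡ a * b →
    (𝒯₁ 𝒯₂ : TreeDS a b ps) →
    IsFactorizationTree a b ps 𝒯₁ → IsFactorizationTree a b ps 𝒯₂ →
    (σ : TreeDS.V 𝒯₁ → TreeDS.V 𝒯₂) → IsHomomorphism 𝒯₁ 𝒯₂ σ →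
    (IsInjective 𝒯₁ 𝒯₂ σ × IsEdgePreserving 𝒯₁ 𝒯₂ σ)
    × ((τ : TreeDS.V 𝒯₁ → TreeDS.V 𝒯₂) → IsHomomorphism 𝒯₁ 𝒯₂ τ →
    ∀ r → σ r ≡ τ r)
theorem2p3 a b _ _ _ ps ps-prime _ _ 𝒯₁ 𝒯₂ ft₁ ft₂ σ hσ =
  (injective , edge-preserving) ,
  homomorphism-unique ps-prime 𝒯₁ 𝒯₂ ft₁ ft₂ σ hσ
  where open Homomorphism ps-prime 𝒯₁ 𝒯₂ ft₁ ft₂ σ hσ
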